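{- Let $n_1, n_2, \delta, \mu$ be positive integers satisfying $\mu(\ln\mu - 2\ln(\delta+2) - 1) \geq n_1 + n_2$. Then there exists a bipartite graph $G$ with the following properties: (1) $V(G) = V \cup \tilde V$ with $V\cap\tilde V=\emptyset$, where both $V$ and $\tilde V$ are independent sets, $V = \{u_1,\dots,u_{n_1}, w_1,\dots,w_{\mu}, z_1,\dots,z_{n_2}\}$ and $\tilde V = \{\tilde u_1,\dots,\tilde u_{n_1}, \tilde w_1,\dots,\tilde w_{\mu}\}$ (all these vertices distinct); (2) $\{\{u_i,\tilde u_i\} \mid 1\leq i\leq n_1\} \cup \{\{w_i,\tilde w_i\}\mid 1\leq i\leq \mu\} \subseteq E(G)$; (3) every vertex $\tilde u_i$, $1\leq i\leq n_1$, has degree $1$ in $G$; (4) for every induced subgraph $S$ of $G$ that can be obtained by deleting vertices from $V$ such that $V\cap V(S)\neq\emptyset$, it holds that $\max_{v\in V\cap V(S)} \mathrm{deg}_S(v) > \max_{v\in\tilde V}\mathrm{deg}_S(v) + \delta$.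
   Context: Graphs are undirected, finite, without multiple edges or self-loops. $\ln$ is the natural logarithm. $\mathrm{deg}_S(v)$ denotes the number of neighbors of $v$ in the graph $S$. An independent set is a set of vertices no two of which are adjacent. -}

module Defs where

open import Data.Nat using (ℕ; zero; suc; _+_; _*_; _^_; _≤_; _<_; _⊔_; _!; _/_)
open import Data.Nat.Properties using (_!≢0)
open import Data.Fin using (Fin)
open import Data.List using (List; []; _∷_; map; _++_; allFin; foldr; filterᵇ; upTo)
open import Data.Bool using (Bool; true; false; if_then_else_; _∧_)
open import Data.Product using (Σ; _×_; ∃)
open import Relation.Binary.PropositionalEquality using (_≡_)

-- The real-number hypothesis  μ(ln μ − 2 ln(δ+2) − 1) ≥ n₁ + n₂.
-- It is equivalent to  μ^μ ≥ (δ+2)^(2μ) · e^(μ+n₁+n₂).  Since the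
-- partial sums  Σ_{j≤N} m^j / j!  increase to e^m, this holds iff for
-- every N:  (δ+2)^(2μ) · Σ_{j≤N} m^j·(N!/j!) ≤ μ^μ · N!  (all in ℕ;
-- j! divides N! so the division is exact).

expPartialScaled : ℕ → ℕ → ℕ
expPartialScaled m N =
  foldr _+_ 0 (map (λ j → m ^ j * ((N !) / (j !)) {{j !≢0}}) (upTo (suc N)))

LnCondition : (n₁ n₂ δ μ : ℕ) → Set
LnCondition n₁ n₂ δ μ =
  ∀ (N : ℕ) → (δ + 2) ^ (2 * μ) * expPartialScaled (μ + (n₁ + n₂)) N ≤ μ ^ μ * N !

-- Vertices.  V = {u₁..u_{n₁}, w₁..w_μ, z₁..z_{n₂}},  Ṽ = {ũ₁..ũ_{n₁}, w̃₁..w̃_μ}.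
-- Distinct constructors / disjoint types make all vertices distinct.

data VVert (n₁ μ n₂ : ℕ) : Set where
  u : Fin n₁ → VVert n₁ μ n₂
  w : Fin μ  → VVert n₁ μ n₂
  z : Fin n₂ → VVert n₁ μ n₂

data TVert (n₁ μ : ℕ) : Set where
  ũ : Fin n₁ → TVert n₁ μ
  w̃ : Fin μ  → TVert n₁ μ

allV : (n₁ μ n₂ : ℕ) → List (VVert n₁ μ n₂)
allV n₁ μ n₂ = map u (allFin n₁) ++ (map w (allFin μ) ++ map z (allFin n₂))

allṼ : (n₁ μ : ℕ) → List (TVert n₁ μ)
allṼ n₁ μ = map ũ (allFin n₁) ++ map w̃ (allFin μ)

-- A graph on V ∪ Ṽ in which V and Ṽ are independent sets is exactly
-- given by its (bipartite) adjacency relation between V and Ṽ.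

BipAdj : (n₁ μ n₂ : ℕ) → Set
BipAdj n₁ μ n₂ = VVert n₁ μ n₂ → TVert n₁ μ → Bool

count : {A : Set} → (A → Bool) → List A → ℕ
count p [] = 0
count p (x ∷ xs) = (if p x then 1 else 0) + count p xs

maximum : List ℕ → ℕ
maximum = foldr _⊔_ 0

module _ {n₁ μ n₂ : ℕ} (adj : BipAdj n₁ μ n₂) where

  degG-Ṽ : TVert n₁ μ → ℕ
  degG-Ṽ t = count (λ v → adj v t) (allV n₁ μ n₂)

  -- S = induced subgraph of G on  K ∪ Ṽ, where K ⊆ V is the set of kept
  -- vertices of V (described by its indicator function).
  -- deg_S of a kept vertex v ∈ V (all of Ṽ is present in S):
  degS-V : (VVert n₁ μ n₂ → Bool) → VVert n₁ μ n₂ → ℕ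
  degS-V K v = count (adj v) (allṼ n₁ μ)

  degS-Ṽ : (VVert n₁ μ n₂ → Bool) → TVert n₁ μ → ℕ
  degS-Ṽ K t = count (λ v → K v ∧ adj v t) (allV n₁ μ n₂)

  maxDegS-V : (VVert n₁ μ n₂ → Bool) → ℕ
  maxDegS-V K = maximum (map (degS-V K) (filterᵇ K (allV n₁ μ n₂)))

  maxDegS-Ṽ : (VVert n₁ μ n₂ → Bool) → ℕ
  maxDegS-Ṽ K = maximum (map (degS-Ṽ K) (allṼ n₁ μ))

-- Order V as u₁ … u_{n₁}, w₁ … w_μ, z₁ … z_{n₂} and call the k-th vertex vₖ (k ≥ 0). Besides
-- the edges uᵢũᵢ and wᵢw̃ᵢ, vₖ is joined to a window of dₖ = δ + 4 + ⌊Fₖ/μ⌋ consecutive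
-- positions of the cyclic sequence w̃₁ … w̃_μ w̃₁ …, where Fₖ = d₀ + ⋯ + d_{k-1}. If vₖ is the
-- last vertex of V kept in S and dₖ ≤ μ, then vₖ has dₖ distinct neighbours, while each w̃ⱼ
-- lies in at most ⌈F_{k+1}/μ⌉ ≤ ⌊Fₖ/μ⌋ + 2 of the windows of v₀ … vₖ and has one more
-- neighbour wⱼ, and each ũᵢ has degree 1; so all degrees in Ṽ are below dₖ - δ.
-- It remains to see dₖ ≤ μ for k < |V| = μ + n₁ + n₂. Since Fₖ + μ(δ + 4) grows by a factor
-- at most 1 + 1/μ per step, dₖ ≤ (δ + 4)(1 + 1/μ)^k. By the binomial theorem
-- (1 + 1/μ)^(μx) ≤ eˣ, so the hypothesis μ^μ ≥ (δ + 2)^(2μ) e^|V| gives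
-- (δ + 2)² (1 + 1/μ)^|V| ≤ μ, and δ + 4 ≤ (δ + 2)².
module Submission where

open import Defs
open import Data.Nat
open import Data.Nat.Properties
open import Data.Nat.DivMod
open import Data.Nat.Divisibility using (∣-refl; m≤n⇒m!∣n!)
open import Data.Nat.Combinatorics using (_C_; _P_; nCk≡nPk/k!; k>n⇒nCk≡0)
open import Data.Nat.Combinatorics.Base using (_P′_)
open import Data.Nat.Tactic.RingSolver using (solve-∀)
open import Algebra.Properties.CommutativeSemigroup +-commutativeSemigroup
  using () renaming (interchange to +-interchange; xy∙z≈xz∙y to +-right-comm)
open import Algebra.Properties.CommutativeSemigroup *-commutativeSemigroup
  using (x∙yz≈y∙xz; x∙yz≈z∙yx) renaming (interchange to *-interchange)
import Algebra.Properties.CommutativeSemiring.Binomial +-*-commutativeSemiring as Binomial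
import Algebra.Definitions.RawMonoid +-0-rawMonoid as Additive
import Algebra.Definitions.RawSemiring +-*-rawSemiring as Semiring
open import Data.Bool using (Bool; true; false; if_then_else_; _∧_; _∨_; T; T?)
open import Data.Bool.Properties using (T-≡)
open import Data.Fin using (Fin; toℕ)
import Data.Fin as Fin
open import Data.Fin.Properties using (toℕ<n)
open import Data.List using ([]; _∷_; map; _++_; foldr; allFin; tabulate; applyUpTo; filterᵇ)
open import Data.List.Properties using (map-tabulate)
open import Data.List.Membership.Propositional using (_∈_)
open import Data.List.Membership.Propositional.Properties
  using (∈-map⁺; ∈-++⁺ˡ; ∈-++⁺ʳ; ∈-allFin; ∈-filter⁺)
open import Data.List.Relation.Unary.Any using (here; there)
import Data.List.Relation.Unary.All as All
open import Data.List.Relation.Unary.All.Properties using (all-filter)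
open import Data.List.Extrema.Nat using (argmax; argmax-all; f[xs]≤f[argmax])
open import Data.Product using (Σ; _×_; _,_; ∃)
open import Function using (_∘_; id)
open import Function.Bundles using (Equivalence)
open import Relation.Binary.PropositionalEquality
open import Relation.Nullary using (Dec; does; yes; no; contradiction)
open import Relation.Nullary.Decidable using (dec-true; dec-false)

∑< : ℕ → (ℕ → ℕ) → ℕ
∑< zero    f = 0
∑< (suc n) f = f 0 + ∑< n (f ∘ suc)

syntax ∑< n (λ j → e) = ∑[ j < n ] e

∑-cong : ∀ n {f g : ℕ → ℕ} → (∀ j → j < n → f j ≡ g j) → ∑< n f ≡ ∑< n g
∑-cong zero    eq = refl
∑-cong (suc n) eq = cong₂ _+_ (eq 0 z<s) (∑-cong n (λ j j<n → eq (suc j) (s<s j<n)))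

∑-mono : ∀ n {f g : ℕ → ℕ} → (∀ j → j < n → f j ≤ g j) → ∑< n f ≤ ∑< n g
∑-mono zero    le = z≤n
∑-mono (suc n) le = +-mono-≤ (le 0 z<s) (∑-mono n (λ j j<n → le (suc j) (s<s j<n)))

∑-zero : ∀ n → ∑[ j < n ] 0 ≡ 0
∑-zero zero    = refl
∑-zero (suc n) = ∑-zero n

∑-+ : ∀ n (f g : ℕ → ℕ) → ∑[ j < n ] (f j + g j) ≡ ∑< n f + ∑< n g
∑-+ zero    f g = refl
∑-+ (suc n) f g = trans (cong (f 0 + g 0 +_) (∑-+ n (f ∘ suc) (g ∘ suc)))
                        (+-interchange (f 0) (g 0) _ _)

*-distribˡ-∑ : ∀ n c (f : ℕ → ℕ) → c * ∑< n f ≡ ∑[ j < n ] (c * f j)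
*-distribˡ-∑ zero    c f = *-zeroʳ c
*-distribˡ-∑ (suc n) c f =
  trans (*-distribˡ-+ c (f 0) _) (cong (c * f 0 +_) (*-distribˡ-∑ n c (f ∘ suc)))

∑-split : ∀ m n (f : ℕ → ℕ) → ∑< (m + n) f ≡ ∑< m f + ∑[ j < n ] f (m + j)
∑-split zero    n f = refl
∑-split (suc m) n f = trans (cong (f 0 +_) (∑-split m n (f ∘ suc))) (sym (+-assoc (f 0) _ _))

∑-last : ∀ n (f : ℕ → ℕ) → ∑< (suc n) f ≡ ∑< n f + f n
∑-last zero    f = +-identityʳ (f 0)
∑-last (suc n) f = trans (cong (f 0 +_) (∑-last n (f ∘ suc))) (sym (+-assoc (f 0) _ _))

sum-applyUpTo : ∀ n (g f : ℕ → ℕ) → foldr _+_ 0 (map g (applyUpTo f n)) ≡ ∑[ j < n ] g (f j)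
sum-applyUpTo zero    g f = refl
sum-applyUpTo (suc n) g f = cong (g (f 0) +_) (sum-applyUpTo n g (f ∘ suc))

ind : Bool → ℕ
ind b = if b then 1 else 0

ind-∧≤ : ∀ a b → ind (a ∧ b) ≤ ind b
ind-∧≤ true  b = ≤-refl
ind-∧≤ false b = z≤n

ind≤ind-∨ : ∀ a b → ind b ≤ ind (a ∨ b)
ind≤ind-∨ true  true  = ≤-refl
ind≤ind-∨ true  false = z≤n
ind≤ind-∨ false b     = ≤-refl

ind-∧-∨≤ : ∀ a b c → ind (a ∧ (b ∨ c)) ≤ ind b + ind (a ∧ c)
ind-∧-∨≤ false b     c = z≤n
ind-∧-∨≤ true  true  c = s≤s z≤n
ind-∧-∨≤ true  false c = ≤-refl

ind-∧-monoˡ : ∀ {a b} c → (a ≡ true → b ≡ true) → ind (a ∧ c) ≤ ind (b ∧ c)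
ind-∧-monoˡ {false} c _   = z≤n
ind-∧-monoˡ {true}  c a⇒b rewrite a⇒b refl = ≤-refl

≤+ind< : ∀ {a b} (a<?b : Dec (a < b)) → b ≤ suc a → b ≤ a + ind (does a<?b)
≤+ind< {a} (yes _)  b≤1+a = ≤-trans b≤1+a (≤-reflexive (+-comm 1 a))
≤+ind< {a} (no a≮b) _     = ≤-trans (≮⇒≥ a≮b) (m≤m+n a 0)

+ind<≤ : ∀ {a b} (a<?b : Dec (a < b)) → a ≤ b → a + ind (does a<?b) ≤ b
+ind<≤ {a} (yes a<b) _   = ≤-trans (≤-reflexive (+-comm a 1)) a<b
+ind<≤ {a} (no _)    a≤b = ≤-trans (≤-reflexive (+-identityʳ a)) a≤b

∑-ind-≟ : ∀ n x → x < n → ∑[ j < n ] ind (does (j ≟ x)) ≡ 1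
∑-ind-≟ (suc n) zero    _         = cong suc (∑-zero n)
∑-ind-≟ (suc n) (suc x) (s<s x<n) = ∑-ind-≟ n x x<n

∑-ind-truncate : ∀ {s n} (b : ℕ → Bool) → s ≤ n →
                 ∑[ j < n ] ind (does (j <? s) ∧ b j) ≡ ∑[ j < s ] ind (b j)
∑-ind-truncate {s} b s≤n with m≤n⇒∃[o]m+o≡n s≤n
... | r , refl = begin
  ∑[ j < s + r ] ind (does (j <? s) ∧ b j)                          ≡⟨ ∑-split s r _ ⟩
  ∑[ j < s ] ind (does (j <? s) ∧ b j) + ∑[ j < r ] ind (does (s + j <? s) ∧ b (s + j))
    ≡⟨ cong₂ _+_ (∑-cong s (λ j j<s → cong (λ c → ind (c ∧ b j)) (dec-true (j <? s) j<s)))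
                 (∑-cong r (λ j _ → cong (λ c → ind (c ∧ b (s + j))) (dec-false (s + j <? s) (m+n≮m s j)))) ⟩
  ∑[ j < s ] ind (b j) + ∑[ j < r ] 0                              ≡⟨ cong (∑[ j < s ] ind (b j) +_) (∑-zero r) ⟩
  ∑[ j < s ] ind (b j) + 0                                          ≡⟨ +-identityʳ _ ⟩
  ∑[ j < s ] ind (b j)                                              ∎
  where open ≡-Reasoning

∑-ascents≤ : ∀ (f : ℕ → ℕ) → (∀ j → f j ≤ f (suc j)) →
             ∀ n → ∑[ j < n ] ind (does (f j <? f (suc j))) ≤ f n
∑-ascents≤ f mono zero    = z≤n
∑-ascents≤ f mono (suc n) = begin
  ∑[ j < suc n ] ind (does (f j <? f (suc j)))                              ≡⟨ ∑-last n _ ⟩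
  ∑[ j < n ] ind (does (f j <? f (suc j))) + ind (does (f n <? f (suc n)))  ≤⟨ +-monoˡ-≤ _ (∑-ascents≤ f mono n) ⟩
  f n + ind (does (f n <? f (suc n)))                                       ≤⟨ +ind<≤ (f n <? f (suc n)) (mono n) ⟩
  f (suc n)                                                                 ∎
  where open ≤-Reasoning

module _ {A : Set} where

  count-++ : ∀ (p : A → Bool) xs ys → count p (xs ++ ys) ≡ count p xs + count p ys
  count-++ p []       ys = refl
  count-++ p (x ∷ xs) ys = trans (cong (ind (p x) +_) (count-++ p xs ys)) (sym (+-assoc (ind (p x)) _ _))

  count-map : ∀ {B : Set} (p : A → Bool) (f : B → A) xs → count p (map f xs) ≡ count (p ∘ f) xs
  count-map p f []       = refl
  count-map p f (x ∷ xs) = cong (ind (p (f x)) +_) (count-map p f xs)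

  count-mono : ∀ {p q : A → Bool} → (∀ x → ind (p x) ≤ ind (q x)) → ∀ xs → count p xs ≤ count q xs
  count-mono le []       = z≤n
  count-mono le (x ∷ xs) = +-mono-≤ (le x) (count-mono le xs)

  maximum-≥ : ∀ (f : A → ℕ) {x xs} → x ∈ xs → f x ≤ maximum (map f xs)
  maximum-≥ f (here refl) = m≤m⊔n _ _
  maximum-≥ f (there x∈)  = ≤-trans (maximum-≥ f x∈) (m≤n⊔m _ _)

  maximum-≤ : ∀ (f : A → ℕ) {b} → (∀ x → f x ≤ b) → ∀ xs → maximum (map f xs) ≤ b
  maximum-≤ f le []       = z≤n
  maximum-≤ f le (x ∷ xs) = ⊔-lub (le x) (maximum-≤ f le xs)

count-allFin : ∀ n (p : ℕ → Bool) → count (p ∘ toℕ) (allFin n) ≡ ∑[ j < n ] ind (p j)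
count-allFin zero    p = refl
count-allFin (suc n) p = cong (ind (p 0) +_) (begin
  count (p ∘ toℕ) (tabulate {n = n} Fin.suc)   ≡⟨ cong (count (p ∘ toℕ)) (sym (map-tabulate {n = n} id Fin.suc)) ⟩
  count (p ∘ toℕ) (map Fin.suc (allFin n))     ≡⟨ count-map (p ∘ toℕ) Fin.suc (allFin n) ⟩
  count (p ∘ suc ∘ toℕ) (allFin n)             ≡⟨ count-allFin n (p ∘ suc) ⟩
  ∑[ j < n ] ind (p (suc j))                   ∎)
  where open ≡-Reasoning

[m+n]/n≡1+m/n : ∀ m n .{{_ : NonZero n}} → (m + n) / n ≡ suc (m / n)
[m+n]/n≡1+m/n m n = trans (+-distrib-/-∣ʳ m ∣-refl) (trans (cong (m / n +_) (n/n≡1 n)) (+-comm (m / n) 1))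

∑[m+j]/n≡m : ∀ m n .{{_ : NonZero n}} → ∑[ j < n ] ((m + j) / n) ≡ m
∑[m+j]/n≡m zero    n = trans (∑-cong n (λ j j<n → m<n⇒m/n≡0 j<n)) (∑-zero n)
∑[m+j]/n≡m (suc m) n = +-cancelˡ-≡ (m / n) _ _ (begin
  m / n + ∑[ j < n ] ((suc m + j) / n)
    ≡⟨ cong₂ _+_ (cong (_/ n) (sym (+-identityʳ m))) (∑-cong n (λ j _ → cong (_/ n) (sym (+-suc m j)))) ⟩
  ∑[ j < suc n ] ((m + j) / n)              ≡⟨ ∑-last n (λ j → (m + j) / n) ⟩
  ∑[ j < n ] ((m + j) / n) + (m + n) / n    ≡⟨ cong₂ _+_ (∑[m+j]/n≡m m n) ([m+n]/n≡1+m/n m n) ⟩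
  m + suc (m / n)                           ≡⟨ +-suc m (m / n) ⟩
  suc (m + m / n)                           ≡⟨ cong suc (+-comm m (m / n)) ⟩
  suc (m / n + m)                           ≡⟨ sym (+-suc (m / n) m) ⟩
  m / n + suc m                             ∎)
  where open ≡-Reasoning

-- The exponential hypothesis

×≡* : ∀ n x → n Additive.× x ≡ n * x
×≡* zero    x = refl
×≡* (suc n) x = cong (x +_) (×≡* n x)

^≡^ : ∀ x n → x Semiring.^ n ≡ x ^ n
^≡^ x zero    = refl
^≡^ x (suc n) = cong (x *_) (^≡^ x n)

sum≡∑ : ∀ n (t : Fin n → ℕ) (f : ℕ → ℕ) → (∀ i → t i ≡ f (toℕ i)) → Additive.sum t ≡ ∑< n f
sum≡∑ zero    t f eq = refl
sum≡∑ (suc n) t f eq = cong₂ _+_ (eq Fin.zero) (sum≡∑ n (t ∘ Fin.suc) (f ∘ suc) (eq ∘ Fin.suc))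

binomial-theorem : ∀ n x y → (x + y) ^ n ≡ ∑[ k < suc n ] ((n C k) * (x ^ k * y ^ (n ∸ k)))
binomial-theorem n x y = begin
  (x + y) ^ n                       ≡⟨ sym (^≡^ (x + y) n) ⟩
  (x + y) Semiring.^ n              ≡⟨ Binomial.theorem n x y ⟩
  Binomial.binomialExpansion x y n  ≡⟨ sum≡∑ (suc n) _ (λ k → (n C k) * (x ^ k * y ^ (n ∸ k))) term≡ ⟩
  ∑[ k < suc n ] ((n C k) * (x ^ k * y ^ (n ∸ k))) ∎
  where
  open ≡-Reasoning
  term≡ : ∀ i → Binomial.binomialTerm x y n i ≡ (n C toℕ i) * (x ^ toℕ i * y ^ (n ∸ toℕ i))
  term≡ i = trans (×≡* (n C toℕ i) (Binomial.binomial x y n i))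
                  (cong ((n C toℕ i) *_) (cong₂ _*_ (^≡^ x (toℕ i)) (^≡^ y (n ∸ toℕ i))))

nP′k≤n^k : ∀ n k → n P′ k ≤ n ^ k
nP′k≤n^k n zero    = ≤-refl
nP′k≤n^k n (suc k) = *-mono-≤ (m∸n≤m n k) (nP′k≤n^k n k)

nPk≤n^k : ∀ n k → n P k ≤ n ^ k
nPk≤n^k n k with k ≤ᵇ n
... | true  = nP′k≤n^k n k
... | false = z≤n

nCk*k!≤n^k : ∀ n k → (n C k) * k ! ≤ n ^ k
nCk*k!≤n^k n k with k ≤? n
... | yes k≤n = begin
  (n C k) * k !          ≡⟨ cong (_* k !) (nCk≡nPk/k! k≤n) ⟩
  (n P k) / k ! * k !    ≤⟨ m/n*n≤m (n P k) (k !) ⟩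
  n P k                  ≤⟨ nPk≤n^k n k ⟩
  n ^ k                  ∎
  where
  open ≤-Reasoning
  instance _ = k !≢0
... | no k≰n rewrite k>n⇒nCk≡0 (≰⇒> k≰n) = z≤n

^-distribʳ-* : ∀ m n k → (m * n) ^ k ≡ m ^ k * n ^ k
^-distribʳ-* m n zero    = refl
^-distribʳ-* m n (suc k) = trans (cong (m * n *_) (^-distribʳ-* m n k)) (*-interchange m n (m ^ k) (n ^ k))

^-cancelʳ-≤ : ∀ n .{{_ : NonZero n}} {x y} → x ^ n ≤ y ^ n → x ≤ y
^-cancelʳ-≤ n {x} {y} xⁿ≤yⁿ with x ≤? y
... | yes x≤y = x≤y
... | no x≰y  = contradiction xⁿ≤yⁿ (<⇒≱ (^-monoˡ-< n (≰⇒> x≰y)))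

expPartialScaled≡∑ : ∀ x N → expPartialScaled x N ≡ ∑[ j < suc N ] (x ^ j * (N ! / j !) {{j !≢0}})
expPartialScaled≡∑ x N = sum-applyUpTo (suc N) (λ j → x ^ j * (N ! / j !) {{j !≢0}}) id

binomial-term≤ : ∀ μ x N j → N ≤ μ * x → j ≤ N →
                 N ! * ((N C j) * (1 ^ j * μ ^ (N ∸ j))) ≤ μ ^ N * (x ^ j * (N ! / j !) {{j !≢0}})
binomial-term≤ μ x N j N≤μx j≤N = begin
  N ! * ((N C j) * (1 ^ j * μ ^ (N ∸ j)))
    ≡⟨ cong₂ (λ a b → a * ((N C j) * (b * μ ^ (N ∸ j)))) (sym (m/n*n≡m (m≤n⇒m!∣n! j≤N))) (^-zeroˡ j) ⟩
  f * j ! * ((N C j) * (1 * μ ^ (N ∸ j)))   ≡⟨ regroup f (j !) (N C j) (μ ^ (N ∸ j)) ⟩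
  (N C j) * j ! * (μ ^ (N ∸ j) * f)         ≤⟨ *-monoˡ-≤ _ (nCk*k!≤n^k N j) ⟩
  N ^ j * (μ ^ (N ∸ j) * f)                 ≤⟨ *-monoˡ-≤ _ (^-monoˡ-≤ j N≤μx) ⟩
  (μ * x) ^ j * (μ ^ (N ∸ j) * f)           ≡⟨ cong (_* (μ ^ (N ∸ j) * f)) (^-distribʳ-* μ x j) ⟩
  μ ^ j * x ^ j * (μ ^ (N ∸ j) * f)         ≡⟨ *-interchange (μ ^ j) (x ^ j) _ _ ⟩
  μ ^ j * μ ^ (N ∸ j) * (x ^ j * f)         ≡⟨ cong (_* (x ^ j * f)) (sym (^-distribˡ-+-* μ j (N ∸ j))) ⟩
  μ ^ (j + (N ∸ j)) * (x ^ j * f)           ≡⟨ cong (λ e → μ ^ e * (x ^ j * f)) (m+[n∸m]≡n j≤N) ⟩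
  μ ^ N * (x ^ j * f)                       ∎
  where
  open ≤-Reasoning
  instance _ = j !≢0
  f = N ! / j !
  regroup : ∀ f i c p → f * i * (c * (1 * p)) ≡ c * i * (p * f)
  regroup = solve-∀

N!*[1+μ]^N≤μ^N*expPartialScaled : ∀ μ x N → N ≤ μ * x →
                                  N ! * (1 + μ) ^ N ≤ μ ^ N * expPartialScaled x N
N!*[1+μ]^N≤μ^N*expPartialScaled μ x N N≤μx = begin
  N ! * (1 + μ) ^ N
    ≡⟨ cong (N ! *_) (binomial-theorem N 1 μ) ⟩
  N ! * ∑[ j < suc N ] ((N C j) * (1 ^ j * μ ^ (N ∸ j)))
    ≡⟨ *-distribˡ-∑ (suc N) (N !) (λ j → (N C j) * (1 ^ j * μ ^ (N ∸ j))) ⟩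
  ∑[ j < suc N ] (N ! * ((N C j) * (1 ^ j * μ ^ (N ∸ j))))
    ≤⟨ ∑-mono (suc N) (λ j j<1+N → binomial-term≤ μ x N j N≤μx (s≤s⁻¹ j<1+N)) ⟩
  ∑[ j < suc N ] (μ ^ N * (x ^ j * (N ! / j !) {{j !≢0}}))
    ≡⟨ sym (*-distribˡ-∑ (suc N) (μ ^ N) (λ j → x ^ j * (N ! / j !) {{j !≢0}})) ⟩
  μ ^ N * ∑[ j < suc N ] (x ^ j * (N ! / j !) {{j !≢0}})
    ≡⟨ cong (μ ^ N *_) (sym (expPartialScaled≡∑ x N)) ⟩
  μ ^ N * expPartialScaled x N
    ∎
  where open ≤-Reasoning

exp-bound⇒power-bound : ∀ μ .{{_ : NonZero μ}} x c →
                        (∀ N → c ^ μ * expPartialScaled x N ≤ μ ^ μ * N !) →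
                        c * (1 + μ) ^ x ≤ μ ^ suc x
exp-bound⇒power-bound μ x c bound = ^-cancelʳ-≤ μ (*-cancelˡ-≤ (N !) {{N !≢0}} (begin
  N ! * (c * (1 + μ) ^ x) ^ μ               ≡⟨ cong (N ! *_) (power-out c (1 + μ)) ⟩
  N ! * (c ^ μ * (1 + μ) ^ N)               ≡⟨ x∙yz≈y∙xz (N !) (c ^ μ) _ ⟩
  c ^ μ * (N ! * (1 + μ) ^ N)               ≤⟨ *-monoʳ-≤ (c ^ μ) (N!*[1+μ]^N≤μ^N*expPartialScaled μ x N ≤-refl) ⟩
  c ^ μ * (μ ^ N * expPartialScaled x N)    ≡⟨ x∙yz≈y∙xz (c ^ μ) (μ ^ N) _ ⟩
  μ ^ N * (c ^ μ * expPartialScaled x N)    ≤⟨ *-monoʳ-≤ (μ ^ N) (bound N) ⟩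
  μ ^ N * (μ ^ μ * N !)                     ≡⟨ x∙yz≈z∙yx (μ ^ N) (μ ^ μ) (N !) ⟩
  N ! * (μ ^ μ * μ ^ N)                     ≡⟨ cong (N ! *_) (sym (power-out μ μ)) ⟩
  N ! * (μ ^ suc x) ^ μ                     ∎))
  where
  open ≤-Reasoning
  N = μ * x
  power-out : ∀ a b → (a * b ^ x) ^ μ ≡ a ^ μ * b ^ N
  power-out a b = begin-equality
    (a * b ^ x) ^ μ      ≡⟨ ^-distribʳ-* a (b ^ x) μ ⟩
    a ^ μ * (b ^ x) ^ μ  ≡⟨ cong (a ^ μ *_) (^-*-assoc b x μ) ⟩
    a ^ μ * b ^ (x * μ)  ≡⟨ cong (λ e → a ^ μ * b ^ e) (*-comm x μ) ⟩
    a ^ μ * b ^ N        ∎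

power-bound-shrinks : ∀ μ c {k x} → k ≤ x → c * (1 + μ) ^ x ≤ μ ^ suc x → c * (1 + μ) ^ k ≤ μ ^ suc k
power-bound-shrinks μ c {k} k≤x bound with m≤n⇒∃[o]m+o≡n k≤x
... | r , refl = *-cancelʳ-≤ _ _ ((1 + μ) ^ r) {{m^n≢0 (1 + μ) r}} (begin
  c * (1 + μ) ^ k * (1 + μ) ^ r      ≡⟨ *-assoc c _ _ ⟩
  c * ((1 + μ) ^ k * (1 + μ) ^ r)    ≡⟨ cong (c *_) (sym (^-distribˡ-+-* (1 + μ) k r)) ⟩
  c * (1 + μ) ^ (k + r)              ≤⟨ bound ⟩
  μ ^ (suc k + r)                    ≡⟨ ^-distribˡ-+-* μ (suc k) r ⟩
  μ ^ suc k * μ ^ r                  ≤⟨ *-monoʳ-≤ (μ ^ suc k) (^-monoˡ-≤ r (n≤1+n μ)) ⟩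
  μ ^ suc k * (1 + μ) ^ r            ∎)
  where open ≤-Reasoning

4+δ≤[δ+2]² : ∀ δ → 4 + δ ≤ (δ + 2) ^ 2
4+δ≤[δ+2]² δ = ≤-trans (m≤m+n (4 + δ) (δ * (3 + δ))) (≤-reflexive (expand δ))
  where
  expand : ∀ δ → 4 + δ + δ * (3 + δ) ≡ (δ + 2) * ((δ + 2) * 1)
  expand = solve-∀

LnCondition⇒[4+δ][1+μ]^k≤μ^[1+k] : ∀ n₁ n₂ δ μ .{{_ : NonZero μ}} → LnCondition n₁ n₂ δ μ →
                   ∀ k → k ≤ μ + (n₁ + n₂) → (4 + δ) * (1 + μ) ^ k ≤ μ ^ suc k
LnCondition⇒[4+δ][1+μ]^k≤μ^[1+k] n₁ n₂ δ μ ln k k≤x = begin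
  (4 + δ) * (1 + μ) ^ k        ≤⟨ *-monoˡ-≤ _ (4+δ≤[δ+2]² δ) ⟩
  (δ + 2) ^ 2 * (1 + μ) ^ k    ≤⟨ power-bound-shrinks μ ((δ + 2) ^ 2) k≤x (exp-bound⇒power-bound μ _ _ ln′) ⟩
  μ ^ suc k                    ∎
  where
  open ≤-Reasoning
  ln′ : ∀ N → ((δ + 2) ^ 2) ^ μ * expPartialScaled (μ + (n₁ + n₂)) N ≤ μ ^ μ * N !
  ln′ N = subst (λ c → c * expPartialScaled (μ + (n₁ + n₂)) N ≤ μ ^ μ * N !)
                (sym (^-*-assoc (δ + 2) 2 μ)) (ln N)

-- Round-robin windows

-- hits p t = ⌊(p + t)/μ⌋ counts the positions q < p with μ ∣ q + t + 1: position q lies in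
-- column t ≡ -(q + 1) (mod μ). Vertex k owns the positions filled k ≤ q < filled (suc k).
module RoundRobin (μ : ℕ) .{{_ : NonZero μ}} (a : ℕ) where

  filled : ℕ → ℕ
  filled zero    = 0
  filled (suc k) = filled k + (a + filled k / μ)

  width : ℕ → ℕ
  width k = a + filled k / μ

  hits : ℕ → ℕ → ℕ
  hits p t = (p + t) / μ

  crosses : ℕ → ℕ → ℕ → Bool
  crosses p p′ t = does (hits p t <? hits p′ t)

  covers : ℕ → ℕ → Bool
  covers k = crosses (filled k) (filled (suc k))

  hits-+≤ : ∀ p d t → d ≤ μ → hits (p + d) t ≤ suc (hits p t)
  hits-+≤ p d t d≤μ = begin
    (p + d + t) / μ     ≤⟨ /-monoˡ-≤ μ (≤-trans (≤-reflexive (+-right-comm p d t)) (+-monoʳ-≤ (p + t) d≤μ)) ⟩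
    (p + t + μ) / μ     ≡⟨ [m+n]/n≡1+m/n (p + t) μ ⟩
    suc ((p + t) / μ)   ∎
    where open ≤-Reasoning

  ≤∑crosses : ∀ p d → d ≤ μ → d ≤ ∑[ t < μ ] ind (crosses p (p + d) t)
  ≤∑crosses p d d≤μ = +-cancelˡ-≤ p d _ (begin
    p + d                                                   ≡⟨ sym (∑[m+j]/n≡m (p + d) μ) ⟩
    ∑[ t < μ ] hits (p + d) t
      ≤⟨ ∑-mono μ (λ t _ → ≤+ind< (hits p t <? hits (p + d) t) (hits-+≤ p d t d≤μ)) ⟩
    ∑[ t < μ ] (hits p t + ind (crosses p (p + d) t))      ≡⟨ ∑-+ μ (hits p) _ ⟩
    ∑[ t < μ ] hits p t + ∑[ t < μ ] ind (crosses p (p + d) t)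
      ≡⟨ cong (_+ ∑[ t < μ ] ind (crosses p (p + d) t)) (∑[m+j]/n≡m p μ) ⟩
    p + ∑[ t < μ ] ind (crosses p (p + d) t)                ∎)
    where open ≤-Reasoning

  width≤∑covers : ∀ k → width k ≤ μ → width k ≤ ∑[ t < μ ] ind (covers k t)
  width≤∑covers k = ≤∑crosses (filled k) (width k)

  ∑covers≤hits : ∀ t n → ∑[ j < n ] ind (covers j t) ≤ hits (filled n) t
  ∑covers≤hits t = ∑-ascents≤ (λ j → hits (filled j) t)
                              (λ j → /-monoˡ-≤ μ (+-monoˡ-≤ t (m≤m+n (filled j) (width j))))

  filled-step : ∀ s → μ * (s + (a + s / μ) + μ * a) ≤ (1 + μ) * (s + μ * a)
  filled-step s = begin
    μ * (s + (a + s / μ) + μ * a)              ≡⟨ expand μ s a (s / μ) ⟩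
    s / μ * μ + (μ * s + μ * a + μ * (μ * a))  ≤⟨ +-monoˡ-≤ _ (m/n*n≤m s μ) ⟩
    s + (μ * s + μ * a + μ * (μ * a))          ≡⟨ collect μ s a ⟩
    (1 + μ) * (s + μ * a)                      ∎
    where
    open ≤-Reasoning
    expand : ∀ μ s a q → μ * (s + (a + q) + μ * a) ≡ q * μ + (μ * s + μ * a + μ * (μ * a))
    expand = solve-∀
    collect : ∀ μ s a → s + (μ * s + μ * a + μ * (μ * a)) ≡ (1 + μ) * (s + μ * a)
    collect = solve-∀

  filled-growth : ∀ k → μ ^ k * (filled k + μ * a) ≤ μ * a * (1 + μ) ^ k
  filled-growth zero    = ≤-reflexive (trans (*-identityˡ _) (sym (*-identityʳ _)))
  filled-growth (suc k) = begin
    μ * μ ^ k * (filled (suc k) + μ * a)     ≡⟨ *-assoc μ (μ ^ k) _ ⟩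
    μ * (μ ^ k * (filled (suc k) + μ * a))   ≡⟨ x∙yz≈y∙xz μ (μ ^ k) _ ⟩
    μ ^ k * (μ * (filled (suc k) + μ * a))   ≤⟨ *-monoʳ-≤ (μ ^ k) (filled-step (filled k)) ⟩
    μ ^ k * ((1 + μ) * (filled k + μ * a))   ≡⟨ x∙yz≈y∙xz (μ ^ k) (1 + μ) _ ⟩
    (1 + μ) * (μ ^ k * (filled k + μ * a))   ≤⟨ *-monoʳ-≤ (1 + μ) (filled-growth k) ⟩
    (1 + μ) * (μ * a * (1 + μ) ^ k)          ≡⟨ x∙yz≈y∙xz (1 + μ) (μ * a) _ ⟩
    μ * a * (1 + μ) ^ suc k                  ∎
    where open ≤-Reasoning

  width≤μ : ∀ k → a * (1 + μ) ^ k ≤ μ ^ suc k → width k ≤ μ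
  width≤μ k room = *-cancelˡ-≤ (μ ^ suc k) {{m^n≢0 μ (suc k)}} (begin
    μ * μ ^ k * (a + q)            ≡⟨ expand μ (μ ^ k) a q ⟩
    μ ^ k * (q * μ + μ * a)        ≤⟨ *-monoʳ-≤ (μ ^ k) (+-monoˡ-≤ (μ * a) (m/n*n≤m (filled k) μ)) ⟩
    μ ^ k * (filled k + μ * a)     ≤⟨ filled-growth k ⟩
    μ * a * (1 + μ) ^ k            ≡⟨ *-assoc μ a _ ⟩
    μ * (a * (1 + μ) ^ k)          ≤⟨ *-monoʳ-≤ μ room ⟩
    μ * μ ^ suc k                  ≡⟨ *-comm μ _ ⟩
    μ ^ suc k * μ                  ∎)
    where
    open ≤-Reasoning
    q = filled k / μ
    expand : ∀ μ p a q → μ * p * (a + q) ≡ p * (q * μ + μ * a)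
    expand = solve-∀

  hits-filled-suc≤ : ∀ k t → width k ≤ μ → t ≤ μ → hits (filled (suc k)) t ≤ 2 + filled k / μ
  hits-filled-suc≤ k t w≤μ t≤μ = begin
    (filled k + width k + t) / μ   ≤⟨ /-monoˡ-≤ μ (+-mono-≤ (+-monoʳ-≤ (filled k) w≤μ) t≤μ) ⟩
    (filled k + μ + μ) / μ         ≡⟨ [m+n]/n≡1+m/n (filled k + μ) μ ⟩
    suc ((filled k + μ) / μ)       ≡⟨ cong suc ([m+n]/n≡1+m/n (filled k) μ) ⟩
    2 + filled k / μ               ∎
    where open ≤-Reasoning

-- The graph

module Construction (n₁ n₂ δ μ : ℕ) .{{_ : NonZero μ}} where

  open RoundRobin μ (4 + δ)

  m : ℕ
  m = n₁ + μ + n₂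

  idx : VVert n₁ μ n₂ → ℕ
  idx (u i) = toℕ i
  idx (w i) = n₁ + toℕ i
  idx (z i) = n₁ + μ + toℕ i

  idx<m : ∀ v → idx v < m
  idx<m (u i) = <-≤-trans (toℕ<n i) (≤-trans (m≤m+n n₁ μ) (m≤m+n (n₁ + μ) n₂))
  idx<m (w i) = <-≤-trans (+-monoʳ-< n₁ (toℕ<n i)) (m≤m+n (n₁ + μ) n₂)
  idx<m (z i) = +-monoʳ-< (n₁ + μ) (toℕ<n i)

  allV-complete : ∀ v → v ∈ allV n₁ μ n₂
  allV-complete (u i) = ∈-++⁺ˡ (∈-map⁺ u (∈-allFin i))
  allV-complete (w i) = ∈-++⁺ʳ (map u (allFin n₁)) (∈-++⁺ˡ (∈-map⁺ w (∈-allFin i)))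
  allV-complete (z i) = ∈-++⁺ʳ (map u (allFin n₁)) (∈-++⁺ʳ (map w (allFin μ)) (∈-map⁺ z (∈-allFin i)))

  adj : BipAdj n₁ μ n₂
  adj v (ũ i) = does (idx v ≟ toℕ i)
  adj v (w̃ t) = does (idx v ≟ n₁ + toℕ t) ∨ covers (idx v) (toℕ t)

  adj-u-ũ : ∀ i → adj (u i) (ũ i) ≡ true
  adj-u-ũ i = dec-true (toℕ i ≟ toℕ i) refl

  adj-w-w̃ : ∀ i → adj (w i) (w̃ i) ≡ true
  adj-w-w̃ i = cong (_∨ covers (n₁ + toℕ i) (toℕ i)) (dec-true (n₁ + toℕ i ≟ n₁ + toℕ i) refl)

  count-allV : ∀ (p : ℕ → Bool) → count (p ∘ idx) (allV n₁ μ n₂) ≡ ∑[ j < m ] ind (p j)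
  count-allV p = begin
    count (p ∘ idx) (map u (allFin n₁) ++ (map w (allFin μ) ++ map z (allFin n₂)))
      ≡⟨ trans (count-++ (p ∘ idx) (map u (allFin n₁)) _)
               (cong (count (p ∘ idx) (map u (allFin n₁)) +_) (count-++ (p ∘ idx) (map w (allFin μ)) _)) ⟩
    count (p ∘ idx) (map u (allFin n₁))
      + (count (p ∘ idx) (map w (allFin μ)) + count (p ∘ idx) (map z (allFin n₂)))
      ≡⟨ cong₂ _+_ (trans (count-map (p ∘ idx) u (allFin n₁)) (count-allFin n₁ p))
                   (cong₂ _+_ (trans (count-map (p ∘ idx) w (allFin μ)) (count-allFin μ (p ∘ (n₁ +_))))
                              (trans (count-map (p ∘ idx) z (allFin n₂)) (count-allFin n₂ (p ∘ (n₁ + μ +_))))) ⟩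
    ∑< n₁ f + (∑[ j < μ ] f (n₁ + j) + ∑[ j < n₂ ] f (n₁ + μ + j))
      ≡⟨ sym (+-assoc (∑< n₁ f) _ _) ⟩
    ∑< n₁ f + ∑[ j < μ ] f (n₁ + j) + ∑[ j < n₂ ] f (n₁ + μ + j)
      ≡⟨ cong (_+ ∑[ j < n₂ ] f (n₁ + μ + j)) (sym (∑-split n₁ μ f)) ⟩
    ∑< (n₁ + μ) f + ∑[ j < n₂ ] f (n₁ + μ + j)
      ≡⟨ sym (∑-split (n₁ + μ) n₂ f) ⟩
    ∑< m f ∎
    where
    open ≡-Reasoning
    f = ind ∘ p

  degG-ũ≡1 : ∀ i → degG-Ṽ adj (ũ i) ≡ 1
  degG-ũ≡1 i = trans (count-allV (λ j → does (j ≟ toℕ i))) (∑-ind-≟ m (toℕ i) (idx<m (u i)))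

  degS-ũ≤1 : ∀ K i → degS-Ṽ adj K (ũ i) ≤ 1
  degS-ũ≤1 K i = ≤-trans (count-mono (λ v → ind-∧≤ (K v) (adj v (ũ i))) (allV n₁ μ n₂))
                         (≤-reflexive (degG-ũ≡1 i))

  degS-w̃≤ : ∀ K s → s ≤ m → (∀ v → K v ≡ true → idx v < s) →
            ∀ t → degS-Ṽ adj K (w̃ t) ≤ suc (hits (filled s) (toℕ t))
  degS-w̃≤ K s s≤m kept<s t = begin
    count (λ v → K v ∧ adj v (w̃ t)) (allV n₁ μ n₂)
      ≤⟨ count-mono (λ v → ind-∧-monoˡ (adj v (w̃ t)) (λ Kv → dec-true (idx v <? s) (kept<s v Kv))) (allV n₁ μ n₂) ⟩
    count ((λ j → does (j <? s) ∧ (own j ∨ covers j t′)) ∘ idx) (allV n₁ μ n₂)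
      ≡⟨ count-allV _ ⟩
    ∑[ j < m ] ind (does (j <? s) ∧ (own j ∨ covers j t′))
      ≤⟨ ∑-mono m (λ j _ → ind-∧-∨≤ (does (j <? s)) (own j) (covers j t′)) ⟩
    ∑[ j < m ] (ind (own j) + ind (does (j <? s) ∧ covers j t′))
      ≡⟨ ∑-+ m _ _ ⟩
    ∑[ j < m ] ind (own j) + ∑[ j < m ] ind (does (j <? s) ∧ covers j t′)
      ≡⟨ cong₂ _+_ (∑-ind-≟ m (n₁ + t′) (idx<m (w t))) (∑-ind-truncate (λ j → covers j t′) s≤m) ⟩
    suc (∑[ j < s ] ind (covers j t′))
      ≤⟨ s≤s (∑covers≤hits t′ s) ⟩
    suc (hits (filled s) t′) ∎
    where
    open ≤-Reasoning
    t′ = toℕ t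
    own = λ j → does (j ≟ n₁ + t′)

  width≤degS-V : ∀ K v → width (idx v) ≤ μ → width (idx v) ≤ degS-V adj K v
  width≤degS-V K v w≤μ = begin
    width (idx v)                               ≤⟨ width≤∑covers (idx v) w≤μ ⟩
    ∑[ t < μ ] ind (covers (idx v) t)           ≡⟨ sym (count-allFin μ (covers (idx v))) ⟩
    count (covers (idx v) ∘ toℕ) (allFin μ)     ≤⟨ count-mono (λ t → ind≤ind-∨ (does (idx v ≟ n₁ + toℕ t)) _) (allFin μ) ⟩
    count (adj v ∘ w̃) (allFin μ)                ≡⟨ sym (count-map (adj v) w̃ (allFin μ)) ⟩
    count (adj v) (map w̃ (allFin μ))            ≤⟨ m≤n+m _ _ ⟩
    count (adj v) (map ũ (allFin n₁)) + count (adj v) (map w̃ (allFin μ))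
                                                ≡⟨ sym (count-++ (adj v) (map ũ (allFin n₁)) _) ⟩
    degS-V adj K v                              ∎
    where open ≤-Reasoning

  maxDegS-Ṽ+δ<maxDegS-V : (∀ k → k < m → (4 + δ) * (1 + μ) ^ k ≤ μ ^ suc k) →
               ∀ K → ∃ (λ v → K v ≡ true) → maxDegS-Ṽ adj K + δ < maxDegS-V adj K
  maxDegS-Ṽ+δ<maxDegS-V room K (v₀ , Kv₀) = begin-strict
    maxDegS-Ṽ adj K + δ   ≤⟨ +-monoˡ-≤ δ (maximum-≤ (degS-Ṽ adj K) degS-Ṽ≤ (allṼ n₁ μ)) ⟩
    3 + q + δ             <⟨ ≤-reflexive (cong (4 +_) (+-comm q δ)) ⟩
    width k               ≤⟨ width≤degS-V K v* w≤μ ⟩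
    degS-V adj K v*       ≤⟨ maximum-≥ (degS-V adj K) (kept-∈ K[v*]) ⟩
    maxDegS-V adj K       ∎
    where
    open ≤-Reasoning
    kept = filterᵇ K (allV n₁ μ n₂)
    kept-∈ : ∀ {v} → T (K v) → v ∈ kept
    kept-∈ {v} = ∈-filter⁺ (T? ∘ K) (allV-complete v)
    v* = argmax idx v₀ kept
    K[v*] : T (K v*)
    K[v*] = argmax-all idx {P = T ∘ K} (Equivalence.from T-≡ Kv₀) (all-filter (T? ∘ K) (allV n₁ μ n₂))
    k = idx v*
    q = filled k / μ
    w≤μ = width≤μ k (room k (idx<m v*))
    kept<1+k : ∀ v → K v ≡ true → idx v < suc k
    kept<1+k v Kv = s≤s (All.lookup (f[xs]≤f[argmax] v₀ kept) (kept-∈ (Equivalence.from T-≡ Kv)))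
    degS-Ṽ≤ : ∀ x → degS-Ṽ adj K x ≤ 3 + q
    degS-Ṽ≤ (ũ i) = ≤-trans (degS-ũ≤1 K i) (s≤s z≤n)
    degS-Ṽ≤ (w̃ t) = ≤-trans (degS-w̃≤ K (suc k) (idx<m v*) kept<1+k t)
                            (s≤s (hits-filled-suc≤ k (toℕ t) w≤μ (<⇒≤ (toℕ<n t))))

lemma4p2 : (n₁ n₂ δ μ : ℕ) → 1 ≤ n₁ → 1 ≤ n₂ → 1 ≤ δ → 1 ≤ μ →
    LnCondition n₁ n₂ δ μ →
    Σ (BipAdj n₁ μ n₂) λ adj →
      (∀ i → adj (u i) (ũ i) ≡ true) ×
      (∀ i → adj (w i) (w̃ i) ≡ true) ×
      (∀ i → degG-Ṽ adj (ũ i) ≡ 1) ×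
      (∀ (K : VVert n₁ μ n₂ → Bool) → ∃ (λ v → K v ≡ true) →
        maxDegS-Ṽ adj K + δ < maxDegS-V adj K)
lemma4p2 n₁ n₂ δ μ _ _ _ 1≤μ ln =
  adj , adj-u-ũ , adj-w-w̃ , degG-ũ≡1 ,
  maxDegS-Ṽ+δ<maxDegS-V room
  where
  instance _ = >-nonZero 1≤μ
  open Construction n₁ n₂ δ μ
  |V|≡ : n₁ + μ + n₂ ≡ μ + (n₁ + n₂)
  |V|≡ = trans (cong (_+ n₂) (+-comm n₁ μ)) (+-assoc μ n₁ n₂)
  room : ∀ k → k < n₁ + μ + n₂ → (4 + δ) * (1 + μ) ^ k ≤ μ ^ suc k
  room k k<|V| = LnCondition⇒[4+δ][1+μ]^k≤μ^[1+k] n₁ n₂ δ μ ln k (≤-trans (<⇒≤ k<|V|) (≤-reflexive |V|≡))
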